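{- Let $G$ be a graph and $x\in V(G)$ a vertex with $p:=\chi(G[N(x)])\ge 2$. Let $V_1,\ldots,V_p$ be the color classes of a proper $p$-coloring of $G[N(x)]$ with $|V_1|\ge\cdots\ge|V_p|\ge 1$. If $|V_r\cup\cdots\cup V_p|\le \chi(G)-r-1$ for some integer $r$ with $2\le r\le p$, then $p\le \chi(G)-2$ and $G$ is $(r,\chi(G)+1-r)$-splittable.
   Context: All graphs are finite and simple. $N(x)$ denotes the set of neighbors of $x$ in $G$, and $G[A]$ the subgraph induced by $A\subseteq V(G)$. For positive integers $s,t$, a graph $G$ is $(s,t)$-splittable if $V(G)$ can be partitioned into two sets $S$ and $T$ such that $\chi(G[S])\ge s$ and $\chi(G[T])\ge t$. -}

module Defs where

open import Data.Nat using (ℕ; suc; _≤_; _∸_; _+_; _≤ᵇ_)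
open import Data.Bool using (Bool; true; false; _∧_)
open import Data.Fin using (Fin; toℕ; _≟_)
open import Data.Fin.Subset using (Subset; _∈_; ∁)
open import Data.Vec using (tabulate)
open import Data.Product using (Σ; _×_)
open import Relation.Binary.PropositionalEquality using (_≡_; _≢_)
open import Relation.Nullary.Decidable using (⌊_⌋)

record Graph (n : ℕ) : Set where
  field
    adj    : Fin n → Fin n → Bool
    sym    : ∀ u v → adj u v ≡ adj v u
    irrefl : ∀ v → adj v v ≡ false
open Graph public

N : ∀ {n} → Graph n → Fin n → Subset n
N G x = tabulate (adj G x)

ProperColouring : ∀ {n} → Graph n → Subset n → (k : ℕ) → (Fin n → Fin k) → Set
ProperColouring G A k c =
  ∀ u v → u ∈ A → v ∈ A → adj G u v ≡ true → c u ≢ c v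

Colourable : ∀ {n} → Graph n → Subset n → ℕ → Set
Colourable G A k = Σ (Fin _ → Fin k) (ProperColouring G A k)

ChiGE : ∀ {n} → Graph n → Subset n → ℕ → Set
ChiGE G A s = ∀ m → Colourable G A m → s ≤ m

IsChi : ∀ {n} → Graph n → Subset n → ℕ → Set
IsChi G A k = Colourable G A k × ChiGE G A k

Splittable : ∀ {n} → Graph n → ℕ → ℕ → Set
Splittable G s t = Σ (Subset _) λ S → ChiGE G S s × ChiGE G (∁ S) t

-- colour class V_{i+1} = { v ∈ N(x) : c v = i }  (colours indexed 0..p-1)
ColourClass : ∀ {n p} → Graph n → Fin n → (Fin n → Fin p) → Fin p → Subset n
ColourClass G x c i = tabulate λ v → adj G x v ∧ ⌊ c v ≟ i ⌋

-- V_r ∪ ... ∪ V_p  (1-based r): vertices of N(x) whose 0-based colour +1 is ≥ r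
TailUnion : ∀ {n p} → Graph n → Fin n → (Fin n → Fin p) → ℕ → Subset n
TailUnion G x c r = tabulate λ v → adj G x v ∧ (r ≤ᵇ suc (toℕ (c v)))

{-# OPTIONS --safe #-}
-- Let W = V_r ∪ ⋯ ∪ V_p, S = {x} ∪ V₁ ∪ ⋯ ∪ V_{r−1} and T = V(G) ∖ S, with k = χ(G).
-- If G[S] had a colouring with fewer than r colours, the colours other than that of x,
-- fewer than r − 2 of them, would colour V₁ ∪ ⋯ ∪ V_{r−1}; with the colours of W shifted
-- down by one this colours G[N(x)] with p − 1 colours.  If G[T] had a colouring with at
-- most k − r colours, one of them would be unused on W since |W| < k − r; giving it to x
-- and r − 1 fresh colours to V₁ ∪ ⋯ ∪ V_{r−1} colours G with k − 1 colours.  Finally the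
-- p − r + 1 nonempty classes in W give p + 2 ≤ k.
module Submission where

open import Defs
open import Data.Nat using (ℕ; suc; _≤_; _∸_; _+_)
open import Data.Fin using (Fin; toℕ)
open import Data.Fin.Subset using (⊤; ∣_∣)
open import Data.Product using (_×_)
open import Data.Nat using (zero; _<_; z≤n; s≤s; s≤s⁻¹)
open import Data.Nat.Properties using (<⇒≢; >⇒≢; <⇒≱; <⇒≤; ≰⇒>; ≤-trans; <-≤-trans; _≤?_; _<?_; ≤ᵇ⇒≤; ≤⇒≤ᵇ; ∸-cancelʳ-≡; ∸-monoˡ-≤; ∸-monoˡ-<; ∸-monoʳ-<; ∸-monoʳ-≤; m+n≤o⇒n≤o; m+n≤o⇒m≤o; m+n≤o⇒m≤o∸n; +-comm; +-suc; +-monoʳ-<; +-monoˡ-≤; +-∸-assoc; +-∸-comm; +-cancelˡ-≡; m∸n+n≡m; m+[n∸m]≡n; m<n⇒0<n; m<1+n⇒m≤n; m≤m+n; n≤1+n; module ≤-Reasoning) renaming (_≟_ to _≟ℕ_)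
open import Data.Bool using (Bool; true; T; if_then_else_; _∧_)
open import Data.Bool.Properties using (T-≡)
open import Data.Fin using (zero; suc; fromℕ<; punchOut; _≟_)
open import Data.Fin.Properties using (suc-injective; toℕ-injective; toℕ-fromℕ<; toℕ<n; punchOut-injective; pigeonhole; any?; ¬∀⟶∃¬)
import Data.Fin.Properties as Fin
open import Data.Fin.Subset using (Subset; _∈_; _∉_; inside; outside; Nonempty; ⁅_⁆; _∪_; _∩_; ∁)
open import Data.Fin.Subset.Properties using (_∈?_; x∈p∪q⁺; x∈p∪q⁻; x∈p∩q⁺; x∈p∩q⁻; x∈⁅x⁆; x∈⁅y⁆⇒x≡y; x∉p⇒x∈∁p; x∈∁p⇒x∉p; x∉∁p⇒x∈p)
open import Data.Vec using (_∷_; here; there; tabulate)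
open import Data.Vec.Properties using ([]=⇒lookup; lookup⇒[]=; lookup∘tabulate)
open import Data.Sum using (inj₁; inj₂)
open import Data.Product using (∃; _,_; proj₁; proj₂)
open import Function using (_∘_)
open import Function.Bundles using (Equivalence)
open import Level using (0ℓ)
open import Relation.Binary.PropositionalEquality using (_≡_; _≢_; refl; trans; cong; cong₂; subst; ≢-sym) renaming (sym to ≡-sym)
open import Relation.Nullary using (¬_; yes; no; does; contradiction)
open import Relation.Nullary.Decidable using (_×-dec_; toWitness)
open import Relation.Unary using (Pred; Decidable; _⊆_) renaming (_∩_ to _∩ᵖ_)

module _ {n} {f : Fin n → Bool} {v : Fin n} where

  ∈-tabulate⁺ : f v ≡ true → v ∈ tabulate f
  ∈-tabulate⁺ fv = lookup⇒[]= v (tabulate f) (trans (lookup∘tabulate f v) fv)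

  ∈-tabulate⁻ : v ∈ tabulate f → f v ≡ true
  ∈-tabulate⁻ v∈ = trans (≡-sym (lookup∘tabulate f v)) ([]=⇒lookup v∈)

rank : ∀ {n} {v : Fin n} (A : Subset n) → v ∈ A → Fin ∣ A ∣
rank (inside ∷ A)  here        = zero
rank (inside ∷ A)  (there v∈A) = suc (rank A v∈A)
rank (outside ∷ A) (there v∈A) = rank A v∈A

rank-injective : ∀ {n} {u v : Fin n} (A : Subset n) (u∈A : u ∈ A) (v∈A : v ∈ A) →
                 rank A u∈A ≡ rank A v∈A → u ≡ v
rank-injective (inside ∷ A)  here        here        _  = refl
rank-injective (inside ∷ A)  (there u∈A) (there v∈A) eq = cong suc (rank-injective A u∈A v∈A (suc-injective eq))
rank-injective (outside ∷ A) (there u∈A) (there v∈A) eq = cong suc (rank-injective A u∈A v∈A eq)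

module _ {n t} (A : Subset n) (g : Fin t → Fin n) (g∈A : ∀ j → g j ∈ A)
         (g-injective : ∀ {i j} → g i ≡ g j → i ≡ j) where

  injective⇒≤∣p∣ : t ≤ ∣ A ∣
  injective⇒≤∣p∣ with t ≤? ∣ A ∣
  ... | yes t≤∣A∣ = t≤∣A∣
  ... | no t≰∣A∣ with pigeonhole (≰⇒> t≰∣A∣) (λ j → rank A (g∈A j))
  ...   | i , j , i<j , same-rank =
            contradiction (g-injective (rank-injective A (g∈A i) (g∈A j) same-rank)) (Fin.<⇒≢ i<j)

∣p∣>0⇒Nonempty : ∀ {n} (A : Subset n) → 1 ≤ ∣ A ∣ → Nonempty A
∣p∣>0⇒Nonempty (inside ∷ A)  _ = zero , here
∣p∣>0⇒Nonempty (outside ∷ A) 1≤∣A∣ with ∣p∣>0⇒Nonempty A 1≤∣A∣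
... | v , v∈A = suc v , there v∈A

∃-unattained : ∀ {n t} (A : Subset n) (E : Fin n → ℕ) → ∣ A ∣ < t →
               ∃ λ (z : Fin t) → ∀ {w} → w ∈ A → E w ≢ toℕ z
∃-unattained {n} {t} A E ∣A∣<t =
  let z , unattained = ¬∀⟶∃¬ t Attained Attained? ¬all-attained
  in z , λ w∈A Ew≡z → unattained (_ , w∈A , Ew≡z)
  where
  Attained : Fin t → Set
  Attained z = ∃ λ w → w ∈ A × E w ≡ toℕ z

  Attained? : Decidable Attained
  Attained? z = any? (λ w → (w ∈? A) ×-dec (E w ≟ℕ toℕ z))

  ¬all-attained : ¬ (∀ z → Attained z)
  ¬all-attained attained = <⇒≱ ∣A∣<t (injective⇒≤∣p∣ A preimage (proj₁ ∘ proj₂ ∘ attained) preimage-injective)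
    where
    preimage : Fin t → Fin n
    preimage = proj₁ ∘ attained
    preimage-injective : ∀ {i j} → preimage i ≡ preimage j → i ≡ j
    preimage-injective {i} {j} same = toℕ-injective
      (trans (≡-sym (proj₂ (proj₂ (attained i)))) (trans (cong E same) (proj₂ (proj₂ (attained j)))))

module _ {n} (G : Graph n) where

  Proper : Pred (Fin n) 0ℓ → (Fin n → ℕ) → Set
  Proper P E = ∀ {u v} → P u → P v → adj G u v ≡ true → E u ≢ E v

  proper-⊆ : ∀ {P Q E} → Q ⊆ P → Proper P E → Proper Q E
  proper-⊆ Q⊆P proper Qu Qv = proper (Q⊆P Qu) (Q⊆P Qv)

  properColouring⇒proper : ∀ {A k c} → ProperColouring G A k c → Proper (_∈ A) (toℕ ∘ c)
  properColouring⇒proper proper u∈A v∈A uv = proper _ _ u∈A v∈A uv ∘ toℕ-injective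

  select : {Q : Pred (Fin n) 0ℓ} → Decidable Q → (Fin n → ℕ) → (Fin n → ℕ) → Fin n → ℕ
  select Q? E₁ E₂ v = if does (Q? v) then E₁ v else E₂ v

  proper-select : ∀ {P Q E₁ E₂} (Q? : Decidable Q) →
    Proper (P ∩ᵖ Q) E₁ → Proper (P ∩ᵖ (¬_ ∘ Q)) E₂ →
    (∀ {u v} → P u → Q u → P v → ¬ Q v → adj G u v ≡ true → E₁ u ≢ E₂ v) →
    Proper P (select Q? E₁ E₂)
  proper-select Q? proper₁ proper₂ across {u} {v} Pu Pv uv with Q? u | Q? v
  ... | yes Qu | yes Qv = proper₁ (Pu , Qu) (Pv , Qv) uv
  ... | yes Qu | no ¬Qv = across Pu Qu Pv ¬Qv uv
  ... | no ¬Qu | yes Qv = across Pv Qv Pu ¬Qu (trans (sym G v u) uv) ∘ ≡-sym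
  ... | no ¬Qu | no ¬Qv = proper₂ (Pu , ¬Qu) (Pv , ¬Qv) uv

  labelling⇒colourable : ∀ {A K} (E : Fin n → ℕ) → 0 < K → (∀ {v} → v ∈ A → E v < K) →
                         Proper (_∈ A) E → Colourable G A K
  labelling⇒colourable {A} {K} E 0<K E<K proper = colour , proper-colour
    where
    colour : Fin n → Fin K
    colour v with E v <? K
    ... | yes Ev<K = fromℕ< Ev<K
    ... | no _ = fromℕ< 0<K
    toℕ-colour : ∀ {v} → v ∈ A → toℕ (colour v) ≡ E v
    toℕ-colour {v} v∈A with E v <? K
    ... | yes Ev<K = toℕ-fromℕ< Ev<K
    ... | no Ev≮K = contradiction (E<K v∈A) Ev≮K
    proper-colour : ProperColouring G A K colour
    proper-colour u v u∈A v∈A uv same =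
      proper u∈A v∈A uv (trans (≡-sym (toℕ-colour u∈A)) (trans (cong toℕ same) (toℕ-colour v∈A)))

  ChiGE-intro : ∀ {A s} → (∀ m → m < s → ¬ Colourable G A m) → ChiGE G A s
  ChiGE-intro {s = s} uncolourable m colourable with s ≤? m
  ... | yes s≤m = s≤m
  ... | no s≰m = contradiction colourable (uncolourable m (≰⇒> s≰m))

module _ {m} (a : Fin (suc m)) where

  skip : Fin (suc m) → ℕ
  skip b with a ≟ b
  ... | yes _ = 0
  ... | no a≢b = toℕ (punchOut a≢b)

  skip-< : ∀ {b} → a ≢ b → skip b < m
  skip-< {b} a≢b with a ≟ b
  ... | yes a≡b = contradiction a≡b a≢b
  ... | no a≢b = toℕ<n _

  skip-injective : ∀ {b b′} → a ≢ b → a ≢ b′ → skip b ≡ skip b′ → b ≡ b′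
  skip-injective {b} {b′} a≢b a≢b′ eq with a ≟ b | a ≟ b′
  ... | yes a≡b | _ = contradiction a≡b a≢b
  ... | no _ | yes a≡b′ = contradiction a≡b′ a≢b′
  ... | no a≢b | no a≢b′ = punchOut-injective a≢b a≢b′ (toℕ-injective eq)

module _ {n m} (G : Graph n) {A : Subset n} {d : Fin n → Fin (suc m)}
         (proper : ProperColouring G A (suc m) d) {x : Fin n} (x∈A : x ∈ A) where

  neighbour-colour≢ : ∀ {v} → v ∈ A → v ∈ N G x → d x ≢ d v
  neighbour-colour≢ v∈A v∈N = proper _ _ x∈A v∈A (∈-tabulate⁻ v∈N)

  skip-colour-< : ∀ {v} → v ∈ A → v ∈ N G x → skip (d x) (d v) < m
  skip-colour-< v∈A v∈N = skip-< (d x) (neighbour-colour≢ v∈A v∈N)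

  proper-skip-colour : Proper G ((_∈ A) ∩ᵖ (_∈ N G x)) (skip (d x) ∘ d)
  proper-skip-colour (u∈A , u∈N) (v∈A , v∈N) uv =
    proper _ _ u∈A v∈A uv ∘ skip-injective (d x) (neighbour-colour≢ u∈A u∈N) (neighbour-colour≢ v∈A v∈N)

module _ {n p} (G : Graph n) (x : Fin n) (c : Fin n → Fin p) where

  ∈ColourClass⁻ : ∀ {i v} → v ∈ ColourClass G x c i → v ∈ N G x × c v ≡ i
  ∈ColourClass⁻ {v = v} v∈V with adj G x v in x~v | ∈-tabulate⁻ v∈V
  ... | true | cv≡i = ∈-tabulate⁺ x~v , toWitness (subst T (≡-sym cv≡i) _)

  ∈TailUnion⁻ : ∀ {r v} → v ∈ TailUnion G x c r → v ∈ N G x × r ≤ suc (toℕ (c v))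
  ∈TailUnion⁻ {r} {v} v∈W with adj G x v in x~v | ∈-tabulate⁻ v∈W
  ... | true | high = ∈-tabulate⁺ x~v , ≤ᵇ⇒≤ r _ (subst T (≡-sym high) _)

  ∈TailUnion⁺ : ∀ {r v} → v ∈ N G x → r ≤ suc (toℕ (c v)) → v ∈ TailUnion G x c r
  ∈TailUnion⁺ v∈N high = ∈-tabulate⁺ (cong₂ _∧_ (∈-tabulate⁻ v∈N) (Equivalence.to T-≡ (≤⇒≤ᵇ high)))

  p∸r′≤∣TailUnion∣ : ∀ {r′} → r′ ≤ p → (∀ i → 1 ≤ ∣ ColourClass G x c i ∣) →
                      p ∸ r′ ≤ ∣ TailUnion G x c (suc r′) ∣
  p∸r′≤∣TailUnion∣ {r′} r′≤p nonempty = injective⇒≤∣p∣ _ g g∈W g-injective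
    where
    colour : Fin (p ∸ r′) → Fin p
    colour j = fromℕ< (subst (r′ + toℕ j <_) (m+[n∸m]≡n r′≤p) (+-monoʳ-< r′ (toℕ<n j)))

    representative : ∀ j → Nonempty (ColourClass G x c (colour j))
    representative j = ∣p∣>0⇒Nonempty _ (nonempty (colour j))

    g : Fin (p ∸ r′) → Fin n
    g = proj₁ ∘ representative

    g∈class : ∀ j → g j ∈ N G x × c (g j) ≡ colour j
    g∈class = ∈ColourClass⁻ ∘ proj₂ ∘ representative

    toℕ-c-g : ∀ j → toℕ (c (g j)) ≡ r′ + toℕ j
    toℕ-c-g j = trans (cong toℕ (proj₂ (g∈class j))) (toℕ-fromℕ< _)

    g∈W : ∀ j → g j ∈ TailUnion G x c (suc r′)
    g∈W j = ∈TailUnion⁺ (proj₁ (g∈class j)) (s≤s (subst (r′ ≤_) (≡-sym (toℕ-c-g j)) (m≤m+n r′ _)))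

    g-injective : ∀ {i j} → g i ≡ g j → i ≡ j
    g-injective {i} {j} same = toℕ-injective (+-cancelˡ-≡ r′ _ _
      (trans (≡-sym (toℕ-c-g i)) (trans (cong (toℕ ∘ c) same) (toℕ-c-g j))))

  p+2≤k : ∀ {r k} → 1 ≤ r → r ≤ p → (∀ i → 1 ≤ ∣ ColourClass G x c i ∣) →
          ∣ TailUnion G x c r ∣ + r + 1 ≤ k → p + 2 ≤ k
  p+2≤k {suc r′} {k} (s≤s z≤n) r≤p nonempty ∣W∣+r+1≤k = begin
    p + 2                                     ≡⟨ +-suc p 1 ⟩
    suc p + 1                                 ≡⟨ cong (λ q → suc q + 1) (m∸n+n≡m r′≤p) ⟨
    suc (p ∸ r′ + r′) + 1                     ≡⟨ cong (_+ 1) (+-suc (p ∸ r′) r′) ⟨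
    p ∸ r′ + suc r′ + 1                       ≤⟨ +-monoˡ-≤ 1 (+-monoˡ-≤ (suc r′) (p∸r′≤∣TailUnion∣ r′≤p nonempty)) ⟩
    ∣ TailUnion G x c (suc r′) ∣ + suc r′ + 1 ≤⟨ ∣W∣+r+1≤k ⟩
    k                                         ∎
    where
    open ≤-Reasoning
    r′≤p : r′ ≤ p
    r′≤p = ≤-trans (n≤1+n r′) r≤p

module Split {n p} (G : Graph n) (x : Fin n) (c : Fin n → Fin p) (r : ℕ) where

  W : Subset n
  W = TailUnion G x c r

  S : Subset n
  S = ⁅ x ⁆ ∪ (N G x ∩ ∁ W)

  x∈S : x ∈ S
  x∈S = x∈p∪q⁺ (inj₁ (x∈⁅x⁆ x))

  N∖W⊆S : ∀ {v} → v ∈ N G x → v ∉ W → v ∈ S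
  N∖W⊆S v∈N v∉W = x∈p∪q⁺ (inj₂ (x∈p∩q⁺ (v∈N , x∉p⇒x∈∁p v∉W)))

  module _ (2≤r : 2 ≤ r) (r≤p : r ≤ p) (proper-c : ProperColouring G (N G x) p c) where

    1≤p : 1 ≤ p
    1≤p = ≤-trans (s≤s z≤n) (≤-trans 2≤r r≤p)

    1≤high-colour : ∀ {v} → v ∈ W → 1 ≤ toℕ (c v)
    1≤high-colour v∈W = s≤s⁻¹ (≤-trans 2≤r (proj₂ (∈TailUnion⁻ G x c v∈W)))

    high-label : Fin n → ℕ
    high-label v = toℕ (c v) ∸ 1

    proper-high-label : Proper G ((_∈ N G x) ∩ᵖ (_∈ W)) high-label
    proper-high-label (u∈N , u∈W) (v∈N , v∈W) uv same =
      proper-c _ _ u∈N v∈N uv (toℕ-injective (∸-cancelʳ-≡ (1≤high-colour u∈W) (1≤high-colour v∈W) same))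

    S-colourable⇒N-colourable : ∀ {m} → m < r → Colourable G S m → Colourable G (N G x) (p ∸ 1)
    S-colourable⇒N-colourable {zero} _ (d , _) with d x
    ... | ()
    S-colourable⇒N-colourable {suc m} m<r (d , proper-d) =
      labelling⇒colourable G E (∸-monoˡ-< (≤-trans 2≤r r≤p) (s≤s z≤n)) E-bound E-proper
      where
      E : Fin n → ℕ
      E = select G (_∈? W) high-label (skip (d x) ∘ d)

      skip-label-< : ∀ {v} → v ∈ N G x → v ∉ W → skip (d x) (d v) < m
      skip-label-< v∈N v∉W = skip-colour-< G proper-d x∈S (N∖W⊆S v∈N v∉W) v∈N

      m≤high-label : ∀ {v} → v ∈ W → m ≤ high-label v
      m≤high-label v∈W = ∸-monoˡ-≤ 1 (s≤s⁻¹ (≤-trans m<r (proj₂ (∈TailUnion⁻ G x c v∈W))))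

      E-bound : ∀ {v} → v ∈ N G x → E v < p ∸ 1
      E-bound {v} v∈N with v ∈? W
      ... | yes v∈W = ∸-monoˡ-< (toℕ<n (c v)) (1≤high-colour v∈W)
      ... | no v∉W = <-≤-trans (skip-label-< v∈N v∉W)
                       (≤-trans (∸-monoˡ-≤ 1 (<⇒≤ m<r)) (∸-monoˡ-≤ 1 r≤p))

      E-proper : Proper G (_∈ N G x) E
      E-proper = proper-select G (_∈? W) proper-high-label
        (proper-⊆ G (λ (v∈N , v∉W) → N∖W⊆S v∈N v∉W , v∈N) (proper-skip-colour G proper-d x∈S))
        (λ _ u∈W v∈N v∉W _ → >⇒≢ (<-≤-trans (skip-label-< v∈N v∉W) (m≤high-label u∈W)))

    χ[S]≥r : ChiGE G (N G x) p → ChiGE G S r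
    χ[S]≥r χ[N]≥p = ChiGE-intro G λ m m<r S-colourable →
      <⇒≱ (∸-monoʳ-< (s≤s z≤n) 1≤p) (χ[N]≥p (p ∸ 1) (S-colourable⇒N-colourable m<r S-colourable))

  S∖x⊆N∖W : ∀ {v} → v ∈ S → v ≢ x → v ∈ N G x × v ∉ W
  S∖x⊆N∖W v∈S v≢x with x∈p∪q⁻ ⁅ x ⁆ (N G x ∩ ∁ W) v∈S
  ... | inj₁ v∈⁅x⁆ = contradiction (x∈⁅y⁆⇒x≡y x v∈⁅x⁆) v≢x
  ... | inj₂ v∈low with x∈p∩q⁻ (N G x) (∁ W) v∈low
  ...   | v∈N , v∈∁W = v∈N , x∈∁p⇒x∉p v∈∁W

  module _ {k} (1≤r : 1 ≤ r) (proper-c : ProperColouring G (N G x) p c) (∣W∣+r+1≤k : ∣ W ∣ + r + 1 ≤ k) where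

    r≤k : r ≤ k
    r≤k = m+n≤o⇒n≤o ∣ W ∣ (m+n≤o⇒m≤o (∣ W ∣ + r) ∣W∣+r+1≤k)

    ∣W∣<k∸r : ∣ W ∣ < k ∸ r
    ∣W∣<k∸r = m+n≤o⇒m≤o∸n (suc ∣ W ∣) (subst (_≤ k) (+-comm _ 1) ∣W∣+r+1≤k)

    k∸r≤k∸1 : k ∸ r ≤ k ∸ 1
    k∸r≤k∸1 = ∸-monoʳ-≤ k 1≤r

    low-label : Fin n → ℕ
    low-label v = (k ∸ r) + toℕ (c v)

    low-label-< : ∀ {v} → v ∈ N G x → v ∉ W → low-label v < k ∸ 1
    low-label-< {v} v∈N v∉W = begin-strict
      (k ∸ r) + toℕ (c v)   <⟨ +-monoʳ-< (k ∸ r) (∸-monoˡ-< (≰⇒> (v∉W ∘ ∈TailUnion⁺ G x c {r} v∈N)) (s≤s z≤n)) ⟩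
      (k ∸ r) + (r ∸ 1)     ≡⟨ +-∸-assoc (k ∸ r) 1≤r ⟨
      (k ∸ r + r) ∸ 1       ≡⟨ cong (_∸ 1) (m∸n+n≡m r≤k) ⟩
      k ∸ 1                 ∎
      where open ≤-Reasoning

    ∁S-colourable⇒colourable : ∀ {m} → m ≤ k ∸ r → Colourable G (∁ S) m → Colourable G ⊤ (k ∸ 1)
    ∁S-colourable⇒colourable {m} m≤k∸r (f , proper-f) =
      labelling⇒colourable G E (≤-trans (m<n⇒0<n (toℕ<n z)) k∸r≤k∸1) (λ {v} _ → E-bound v) E-proper
      where
      unattained : ∃ λ (z : Fin (k ∸ r)) → ∀ {w} → w ∈ W → toℕ (f w) ≢ toℕ z
      unattained = ∃-unattained W (toℕ ∘ f) ∣W∣<k∸r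

      z : Fin (k ∸ r)
      z = proj₁ unattained

      f<k∸r : ∀ v → toℕ (f v) < k ∸ r
      f<k∸r v = <-≤-trans (toℕ<n (f v)) m≤k∸r

      E-rest : Fin n → ℕ
      E-rest = select G (_∈? S) low-label (toℕ ∘ f)

      E : Fin n → ℕ
      E = select G (_≟ x) (λ _ → toℕ z) E-rest

      E-bound : ∀ v → E v < k ∸ 1
      E-bound v with v ≟ x
      ... | yes _ = <-≤-trans (toℕ<n z) k∸r≤k∸1
      ... | no v≢x with v ∈? S
      ...   | yes v∈S = let v∈N , v∉W = S∖x⊆N∖W v∈S v≢x in low-label-< v∈N v∉W
      ...   | no _ = <-≤-trans (f<k∸r v) k∸r≤k∸1

      proper-rest : Proper G ((_∈ ⊤) ∩ᵖ (λ v → v ≢ x)) E-rest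
      proper-rest = proper-select G (_∈? S)
        (λ ((_ , u≢x) , u∈S) ((_ , v≢x) , v∈S) uv same →
          proper-c _ _ (proj₁ (S∖x⊆N∖W u∈S u≢x)) (proj₁ (S∖x⊆N∖W v∈S v≢x)) uv (toℕ-injective (+-cancelˡ-≡ (k ∸ r) _ _ same)))
        (proper-⊆ G (λ (_ , v∉S) → x∉p⇒x∈∁p v∉S) (properColouring⇒proper G proper-f))
        (λ _ _ _ _ _ → >⇒≢ (<-≤-trans (f<k∸r _) (m≤m+n (k ∸ r) _)))

      x-label-differs : ∀ {v} → v ≢ x → adj G x v ≡ true → toℕ z ≢ E-rest v
      x-label-differs {v} v≢x xv with v ∈? S
      ... | yes _ = <⇒≢ (<-≤-trans (toℕ<n z) (m≤m+n (k ∸ r) _))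
      ... | no v∉S = ≢-sym (proj₂ unattained (x∉∁p⇒x∈p λ v∈∁W → v∉S (N∖W⊆S (∈-tabulate⁺ xv) (x∈∁p⇒x∉p v∈∁W))))

      E-proper : Proper G (_∈ ⊤) E
      E-proper = proper-select G (_≟ x)
        (λ { (_ , refl) (_ , refl) xx → contradiction (trans (≡-sym xx) (irrefl G x)) λ () })
        proper-rest
        (λ { _ refl _ v≢x xv → x-label-differs v≢x xv })

    χ[∁S]≥k+1∸r : ChiGE G ⊤ k → ChiGE G (∁ S) (k + 1 ∸ r)
    χ[∁S]≥k+1∸r χ≥k = ChiGE-intro G λ m m<k+1∸r ∁S-colourable →
      <⇒≱ (∸-monoʳ-< (s≤s z≤n) (≤-trans 1≤r r≤k))
          (χ≥k (k ∸ 1) (∁S-colourable⇒colourable (m<1+n⇒m≤n (subst (m <_) k+1∸r≡1+k∸r m<k+1∸r)) ∁S-colourable))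
      where
      k+1∸r≡1+k∸r : k + 1 ∸ r ≡ suc (k ∸ r)
      k+1∸r≡1+k∸r = trans (+-∸-comm 1 r≤k) (+-comm _ 1)

lemma2p2 : ∀ {n} (G : Graph n) (x : Fin n) (p k : ℕ) →
    IsChi G (N G x) p → 2 ≤ p → IsChi G ⊤ k →
    (c : Fin n → Fin p) → ProperColouring G (N G x) p c →
    (∀ i j → toℕ i ≤ toℕ j → ∣ ColourClass G x c j ∣ ≤ ∣ ColourClass G x c i ∣) →
    (∀ i → 1 ≤ ∣ ColourClass G x c i ∣) →
    (r : ℕ) → 2 ≤ r → r ≤ p →
    ∣ TailUnion G x c r ∣ + r + 1 ≤ k →
    (p + 2 ≤ k) × Splittable G r (k + 1 ∸ r)
lemma2p2 G x p k (_ , χ[N]≥p) _ (_ , χ≥k) c proper-c _ nonempty r 2≤r r≤p ∣W∣+r+1≤k =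
  p+2≤k G x c 1≤r r≤p nonempty ∣W∣+r+1≤k ,
  S , χ[S]≥r 2≤r r≤p proper-c χ[N]≥p , χ[∁S]≥k+1∸r 1≤r proper-c ∣W∣+r+1≤k χ≥k
  where
  open Split G x c r
  1≤r : 1 ≤ r
  1≤r = ≤-trans (s≤s z≤n) 2≤r
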